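{- Let $m>1$ and let $C_m$ be the category defined in the context. Let $f=(a,\overline{x},i,j)$ be a morphism of $C_m$ from $(\overline{x},i)$ to $(\overline{y},j)$. Fix an integer $b$ with $0\le b\le a$, put $\overline{z_b}=\overline{b}+\overline{x}$, and for each integer $t$ with $0\le t\le i-j-a$ put $k_t=a-b+j+t$ and let $X_{b,t}$ be the factorization $$f=(a-b,\overline{z_b},k_t,j)\circ(b,\overline{x},i,k_t),\qquad (\overline{x},i)\to(\overline{z_b},k_t)\to(\overline{y},j),$$ regarded as an object of the Lawvere interval $I(f)$. Then for $0\le p,t\le i-j-a$, the set $\mathrm{Hom}_{I(f)}(X_{b,t},X_{b,p})$ is non-empty and a singleton if and only if $p\le t$.
   Context: Let $m>1$ be an integer, $\mathbb{Z}_m$ the cyclic group of integers modulo $m$ (residue class of an integer $n$ written $\overline{n}$), $\mathbb{Z}_-$ the set of non-positive integers and $\mathbb{Z}_+$ the set of non-negative integers. The category $C_m$ has object set $\mathbb{Z}_m\times\mathbb{Z}_-$; for objects $(\overline{x},i),(\overline{y},j)$, $\mathrm{Hom}_{C_m}((\overline{x},i),(\overline{y},j))=\{(a,\overline{x},i,j)\mid a\in\mathbb{Z}_+,\ a\le i-j,\ \overline{a}+\overline{x}=\overline{y}\}$; composition is $(b,\overline{y},j,k)\circ(a,\overline{x},i,j)=(a+b,\overline{x},i,k)$ (identities are $(0,\overline{x},i,i)$). For a morphism $f$ of a small category $C$, the Lawvere interval $I(f)$ is the category whose objects are the factorizations $f=u\circ v$ in $C$ (pairs $(v,u)$ with $u\circ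 v=f$), and a morphism from $(v,u)$ to $(v',u')$ is a morphism $h$ of $C$ from the codomain of $v$ to the codomain of $v'$ with $h\circ v=v'$ and $u'\circ h=u$; composition is that of $C$. -}

module Defs where

open import Data.Nat as ℕ using (ℕ; NonZero; _∸_)
open import Data.Nat.DivMod using (_mod_; _%_; %-distribˡ-+; m%n%n≡m%n)
import Data.Nat.Properties as ℕP
open import Data.Fin using (Fin; toℕ)
open import Data.Fin.Properties using (toℕ-injective; toℕ-fromℕ<)
open import Data.Integer as ℤ using (ℤ; +_; 0ℤ; _-_; _≤_)
  renaming (_+_ to _+ℤ_)
import Data.Integer.Properties as ℤP
open import Data.Integer.Tactic.RingSolver using (solve-∀)
open import Data.Product using (Σ; _×_; _,_)
open import Relation.Binary.PropositionalEquality

-- The cyclic group ℤ_m, with elements represented by Fin m.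
-- The residue class of n : ℕ is  n mod m  (written \overline{n} in the paper).

_+ₘ_ : ∀ {m} .{{_ : NonZero m}} → Fin m → Fin m → Fin m
_+ₘ_ {m} u v = (toℕ u ℕ.+ toℕ v) mod m

infixl 6 _+ₘ_

record Obj (m : ℕ) : Set where
  constructor obj
  field
    res    : Fin m
    lvl    : ℤ
    .nonpos : lvl ≤ 0ℤ
open Obj public

-- Morphisms (a, x̄, i, j) : (x̄,i) → (ȳ,j), with a ∈ ℤ_+, a ≤ i - j and
-- ā + x̄ = ȳ.  Since x̄, i (and ȳ, j) are the given source (and target),
-- such a tuple is determined by a together with the two conditions
-- (which are propositions, hence stored irrelevantly).
record Hom {m : ℕ} .{{_ : NonZero m}} (A B : Obj m) : Set where
  constructor mor
  field
    amt    : ℕ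
    .bound : + amt ≤ lvl A - lvl B
    .resEq : (amt mod m) +ₘ res A ≡ res B
open Hom public

private
  %-absorbˡ : ∀ n k m .{{_ : NonZero m}} → (n % m ℕ.+ k) % m ≡ (n ℕ.+ k) % m
  %-absorbˡ n k m = trans (%-distribˡ-+ (n % m) k m)
    (trans (cong (λ v → (v ℕ.+ k % m) % m) (m%n%n≡m%n n m))
           (sym (%-distribˡ-+ n k m)))

  %-absorbʳ : ∀ k n m .{{_ : NonZero m}} → (k ℕ.+ n % m) % m ≡ (k ℕ.+ n) % m
  %-absorbʳ k n m = trans (cong (_% m) (ℕP.+-comm k (n % m)))
    (trans (%-absorbˡ n k m) (cong (_% m) (ℕP.+-comm n k)))

  toℕ-mod : ∀ n m .{{_ : NonZero m}} → toℕ (n mod m) ≡ n % m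
  toℕ-mod n m = toℕ-fromℕ< _

res-assoc : ∀ {m} .{{_ : NonZero m}} (c d : ℕ) (x : Fin m) →
            (c mod m) +ₘ ((d mod m) +ₘ x) ≡ ((d ℕ.+ c) mod m) +ₘ x
res-assoc {m} c d x = toℕ-injective (begin
    toℕ ((c mod m) +ₘ ((d mod m) +ₘ x))
  ≡⟨ toℕ-mod _ m ⟩
    (toℕ (c mod m) ℕ.+ toℕ ((d mod m) +ₘ x)) % m
  ≡⟨ cong₂ (λ p q → (p ℕ.+ q) % m) (toℕ-mod c m) (toℕ-mod _ m) ⟩
    (c % m ℕ.+ (toℕ (d mod m) ℕ.+ X) % m) % m
  ≡⟨ cong (λ p → (c % m ℕ.+ (p ℕ.+ X) % m) % m) (toℕ-mod d m) ⟩
    (c % m ℕ.+ (d % m ℕ.+ X) % m) % m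
  ≡⟨ %-absorbˡ c _ m ⟩
    (c ℕ.+ (d % m ℕ.+ X) % m) % m
  ≡⟨ %-absorbʳ c _ m ⟩
    (c ℕ.+ (d % m ℕ.+ X)) % m
  ≡⟨ cong (_% m) (ℕP.+-comm c _) ⟩
    (d % m ℕ.+ X ℕ.+ c) % m
  ≡⟨ cong (_% m) (ℕP.+-assoc (d % m) X c) ⟩
    (d % m ℕ.+ (X ℕ.+ c)) % m
  ≡⟨ %-absorbˡ d _ m ⟩
    (d ℕ.+ (X ℕ.+ c)) % m
  ≡⟨ cong (_% m) (trans (sym (ℕP.+-assoc d X c))
       (trans (cong (ℕ._+ c) (ℕP.+-comm d X))
       (trans (ℕP.+-assoc X d c) (ℕP.+-comm X (d ℕ.+ c))))) ⟩
    ((d ℕ.+ c) ℕ.+ X) % m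
  ≡⟨ sym (%-absorbˡ (d ℕ.+ c) X m) ⟩
    ((d ℕ.+ c) % m ℕ.+ X) % m
  ≡⟨ cong (λ p → (p ℕ.+ X) % m) (sym (toℕ-mod (d ℕ.+ c) m)) ⟩
    (toℕ ((d ℕ.+ c) mod m) ℕ.+ X) % m
  ≡⟨ sym (toℕ-mod _ m) ⟩
    toℕ (((d ℕ.+ c) mod m) +ₘ x)
  ∎)
  where
    open ≡-Reasoning
    X = toℕ x

private
  sub-telescope : ∀ i j k → (i - j) +ℤ (j - k) ≡ i - k
  sub-telescope = solve-∀

hom-ext : ∀ {m} .{{_ : NonZero m}} {A B : Obj m} {h h' : Hom A B} →
          amt h ≡ amt h' → h ≡ h'
hom-ext {h = mor a _ _} {mor .a _ _} refl = refl

_∘_ : ∀ {m} .{{_ : NonZero m}} {A B C : Obj m} → Hom B C → Hom A B → Hom A C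
_∘_ {m} {A} {B} {C} (mor b hb rb) (mor a ha ra) =
  mor (a ℕ.+ b)
      (subst (_ ≤_) (sub-telescope (lvl A) (lvl B) (lvl C)) (ℤP.+-mono-≤ ha hb))
      (trans (sym (res-assoc b a (res A)))
             (trans (cong ((b mod m) +ₘ_) ra) rb))

infixr 9 _∘_

record Factorization {m : ℕ} .{{_ : NonZero m}} {A B : Obj m} (f : Hom A B) : Set where
  constructor factor
  field
    mid  : Obj m
    v    : Hom A mid
    u    : Hom mid B
    comp : u ∘ v ≡ f
open Factorization public

IHom : ∀ {m} .{{_ : NonZero m}} {A B : Obj m} {f : Hom A B} →
       Factorization f → Factorization f → Set
IHom X Y = Σ (Hom (mid X) (mid Y)) λ h → (h ∘ v X ≡ v Y) × (u Y ∘ h ≡ u X)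

kt : (a b : ℕ) (j : ℤ) (t : ℕ) → ℤ
kt a b j t = + a - + b +ℤ j +ℤ + t

private
  e1' : ∀ A B j i → A - B +ℤ j +ℤ (i - j - A) ≡ i - B
  e1' = solve-∀
  e2' : ∀ A B j T i → i - (A - B +ℤ j +ℤ T) ≡ (i - j - A - T) +ℤ B
  e2' = solve-∀
  e3' : ∀ A B j T → (A - B +ℤ j +ℤ T) - j ≡ (A - B) +ℤ T
  e3' = solve-∀
  e1 : ∀ (a b : ℕ) j i → + a - + b +ℤ j +ℤ (i - j - + a) ≡ i - + b
  e1 a b = e1' (+ a) (+ b)
  e2 : ∀ (a b : ℕ) j (t : ℕ) i → i - (+ a - + b +ℤ j +ℤ + t) ≡ (i - j - + a - + t) +ℤ + b
  e2 a b j t = e2' (+ a) (+ b) j (+ t)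
  e3 : ∀ (a b : ℕ) j (t : ℕ) → (+ a - + b +ℤ j +ℤ + t) - j ≡ (+ a - + b) +ℤ + t
  e3 a b j t = e3' (+ a) (+ b) j (+ t)

  kt≤0 : ∀ (a b : ℕ) (i j : ℤ) (t : ℕ) → i ≤ 0ℤ →
         + t ≤ i - j - + a → kt a b j t ≤ 0ℤ
  kt≤0 a b i j t hi ht =
    ℤP.≤-trans (subst (kt a b j t ≤_) (e1 a b j i) (ℤP.+-monoʳ-≤ (+ a - + b +ℤ j) ht))
               (ℤP.≤-trans (ℤP.i-j≤i i (+ b)) hi)

  v-bound : ∀ (a b : ℕ) (i j : ℤ) (t : ℕ) → + t ≤ i - j - + a →
            + b ≤ i - kt a b j t
  v-bound a b i j t ht = subst (+ b ≤_) (sym (e2 a b j t i))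
    (ℤP.+-monoˡ-≤ (+ b) (ℤP.i≤j⇒0≤j-i ht))

  u-bound : ∀ (a b : ℕ) (j : ℤ) (t : ℕ) → b ℕ.≤ a →
            + (a ∸ b) ≤ kt a b j t - j
  u-bound a b j t hb = subst (+ (a ∸ b) ≤_)
    (trans (cong (_+ℤ + t) (trans (sym (ℤP.⊖-≥ hb)) (sym (ℤP.m-n≡m⊖n a b))))
           (sym (e3 a b j t)))
    (ℤP.i≤i+j (+ (a ∸ b)) (+ t))

X : ∀ {m} .{{_ : NonZero m}} {A B : Obj m} (f : Hom A B) (b : ℕ) → b ℕ.≤ amt f →
    (t : ℕ) → + t ≤ lvl A - lvl B - + amt f → Factorization f
X {m} {A@(obj _ _ hA)} {B} f@(mor a ha ra) b hb t ht =
  factor (obj zb k (kt≤0 a b (lvl A) (lvl B) t hA ht))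
         (mor b (v-bound a b (lvl A) (lvl B) t ht) refl)
         (mor (a ∸ b) (u-bound a b (lvl B) t hb)
              (trans (res-assoc (a ∸ b) b (res A))
                     (trans (cong (λ n → (n mod m) +ₘ res A) (ℕP.m+[n∸m]≡n hb)) ra)))
         (hom-ext (ℕP.m+[n∸m]≡n hb))
  where
    zb = (b mod m) +ₘ res A
    k  = kt a b (lvl B) t

-- A morphism of C_m is determined by its amount a, amounts add under
-- composition, and a morphism with amount 0 between (x̄,i) and (ȳ,j) exists
-- exactly when x̄ = ȳ and j ≤ i.  Now let P, Q be two factorizations of f
-- whose first legs have the same amount.  For a morphism h : P → Q of I(f),
-- the equation h ∘ v_P = v_Q forces amt h = 0, since amounts add under
-- composition; hence
--   * I(f)(P,Q) has at most one element (morphisms of I(f) are determined by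
--     their underlying morphism of C_m, by uniqueness of identity proofs);
--   * if it is inhabited then lvl (mid Q) ≤ lvl (mid P);
--   * conversely, if the middle objects have the same residue and
--     lvl (mid Q) ≤ lvl (mid P), the amount-0 morphism is a morphism of I(f)
--     (the second legs then also have equal amounts, by cancellation in f).
-- The factorizations X_{b,t} and X_{b,p} have first legs of amount b and the
-- same middle residue z̄_b, with middle levels k_t and k_p; since
-- k_p ≤ k_t iff p ≤ t, the proposition follows.
module Submission where

open import Defs
open import Data.Nat using (ℕ; NonZero; _≤_; _<_)
open import Data.Integer using (+_; _-_) renaming (_≤_ to _≤ℤ_)
open import Data.Product using (Σ; _×_)
open import Relation.Binary.PropositionalEquality using (_≡_)

import Data.Nat as ℕ
import Data.Nat.Properties as ℕP
open import Data.Nat.DivMod using (_mod_; m<n⇒m%n≡m; m*n%n≡0)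
import Data.Integer as ℤ
open import Data.Integer using (0ℤ)
import Data.Integer.Properties as ℤP
open import Data.Integer.Tactic.RingSolver using (solve-∀)
open import Data.Fin using (Fin; toℕ)
open import Data.Fin.Properties using (toℕ-injective; toℕ-fromℕ<; toℕ<n)
open import Data.Product using (_,_; proj₁)
open import Function using (_⇔_; mk⇔; Equivalence)
open import Relation.Binary.PropositionalEquality
  using (refl; sym; trans; cong; subst; module ≡-Reasoning)
open import Relation.Nullary.Decidable using (recompute)
open import Axiom.UniquenessOfIdentityProofs.WithK using (uip)

m+n≡m⇒n≡0 : ∀ m {n} → m ℕ.+ n ≡ m → n ≡ 0
m+n≡m⇒n≡0 m {n} e = ℕP.+-cancelˡ-≡ m n 0 (trans e (sym (ℕP.+-identityʳ m)))

module _ {m : ℕ} .{{_ : NonZero m}} where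

  0+ₘ : (x : Fin m) → (0 mod m) +ₘ x ≡ x
  0+ₘ x = toℕ-injective (begin
      toℕ ((0 mod m) +ₘ x)              ≡⟨ toℕ-fromℕ< _ ⟩
      (toℕ (0 mod m) ℕ.+ toℕ x) ℕ.% m  ≡⟨ cong (λ z → (z ℕ.+ toℕ x) ℕ.% m) toℕ-0mod ⟩
      toℕ x ℕ.% m                      ≡⟨ m<n⇒m%n≡m (toℕ<n x) ⟩
      toℕ x                            ∎)
    where
    open ≡-Reasoning
    toℕ-0mod : toℕ (0 mod m) ≡ 0
    toℕ-0mod = trans (toℕ-fromℕ< _) (m*n%n≡0 0 m)

  zero-hom : {A B : Obj m} → lvl B ≤ℤ lvl A → res A ≡ res B → Hom A B
  zero-hom B≤A resA≡resB =
    mor 0 (ℤP.i≤j⇒0≤j-i B≤A) (trans (0+ₘ _) resA≡resB)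

  zero-hom-level : {A B : Obj m} (h : Hom A B) → amt h ≡ 0 → lvl B ≤ℤ lvl A
  zero-hom-level {A} {B} (mor .0 bound _) refl =
    recompute (lvl B ℤP.≤? lvl A) (ℤP.0≤i-j⇒j≤i bound)

  module _ {A B : Obj m} {f : Hom A B} where

    ihom-ext : {P Q : Factorization f} {h h' : IHom P Q} →
               proj₁ h ≡ proj₁ h' → h ≡ h'
    ihom-ext {h = h , e₁ , e₂} {.h , e₁' , e₂'} refl
      rewrite uip e₁ e₁' | uip e₂ e₂' = refl

    second-leg-amt : (P Q : Factorization f) →
                     amt (v P) ≡ amt (v Q) → amt (u P) ≡ amt (u Q)
    second-leg-amt P Q vP≡vQ = ℕP.+-cancelˡ-≡ (amt (v Q)) _ _ (begin
        amt (v Q) ℕ.+ amt (u P)  ≡⟨ cong (ℕ._+ amt (u P)) (sym vP≡vQ) ⟩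
        amt (v P) ℕ.+ amt (u P)  ≡⟨ cong amt (comp P) ⟩
        amt f                    ≡⟨ cong amt (sym (comp Q)) ⟩
        amt (v Q) ℕ.+ amt (u Q)  ∎)
      where open ≡-Reasoning

    ihom-amt-zero : (P Q : Factorization f) → amt (v P) ≡ amt (v Q) →
                    (h : IHom P Q) → amt (proj₁ h) ≡ 0
    ihom-amt-zero P Q vP≡vQ (h , h∘vP≡vQ , _) =
      m+n≡m⇒n≡0 (amt (v P)) (trans (cong amt h∘vP≡vQ) (sym vP≡vQ))

    ihom-unique : (P Q : Factorization f) → amt (v P) ≡ amt (v Q) →
                  (h h' : IHom P Q) → h ≡ h'
    ihom-unique P Q vP≡vQ h h' = ihom-ext {P = P} {Q = Q} (hom-ext
      (trans (ihom-amt-zero P Q vP≡vQ h) (sym (ihom-amt-zero P Q vP≡vQ h'))))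

    ihom-level : (P Q : Factorization f) → amt (v P) ≡ amt (v Q) →
                 IHom P Q → lvl (mid Q) ≤ℤ lvl (mid P)
    ihom-level P Q vP≡vQ h =
      zero-hom-level (proj₁ h) (ihom-amt-zero P Q vP≡vQ h)

    ihom-from-level : (P Q : Factorization f) → amt (v P) ≡ amt (v Q) →
                      res (mid P) ≡ res (mid Q) → lvl (mid Q) ≤ℤ lvl (mid P) →
                      IHom P Q
    ihom-from-level P Q vP≡vQ resP≡resQ Q≤P =
      h , hom-ext (trans (ℕP.+-identityʳ _) vP≡vQ)
        , hom-ext (sym (second-leg-amt P Q vP≡vQ))
      where
      h : Hom (mid P) (mid Q)
      h = zero-hom Q≤P resP≡resQ

kt-≤⇔ : ∀ a b j {p t} → kt a b j p ≤ℤ kt a b j t ⇔ p ≤ t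
kt-≤⇔ a b j {p} {t} = mk⇔ from (λ p≤t → ℤP.+-monoʳ-≤ c (ℤ.+≤+ p≤t))
  where
  c : ℤ.ℤ
  c = + a - + b ℤ.+ j

  shift-difference : ∀ c x y → (c ℤ.+ x) - (c ℤ.+ y) ≡ x - y
  shift-difference = solve-∀

  from : kt a b j p ≤ℤ kt a b j t → p ≤ t
  from kp≤kt = ℤP.drop‿+≤+ (ℤP.0≤i-j⇒j≤i
    (subst (0ℤ ≤ℤ_) (shift-difference c (+ t) (+ p)) (ℤP.i≤j⇒0≤j-i kp≤kt)))

proposition3p2 : (m : ℕ) .{{_ : NonZero m}} → 1 < m →
    (A B : Obj m) (f : Hom A B) (b : ℕ) (hb : b ≤ amt f) (t p : ℕ)
    (ht : + t ≤ℤ lvl A - lvl B - + amt f) (hp : + p ≤ℤ lvl A - lvl B - + amt f) →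
    (IHom (X f b hb t ht) (X f b hb p hp) → p ≤ t)
    × (p ≤ t → Σ (IHom (X f b hb t ht) (X f b hb p hp)) (λ h → (h' : IHom (X f b hb t ht) (X f b hb p hp)) → h' ≡ h))
proposition3p2 m _ A B f b hb t p ht hp =
  (λ h → Equivalence.to levels (ihom-level Xt Xp refl h)) ,
  (λ p≤t → let h = ihom-from-level Xt Xp refl refl (Equivalence.from levels p≤t)
           in h , λ h' → ihom-unique Xt Xp refl h' h)
  where
  Xt Xp : Factorization f
  Xt = X f b hb t ht
  Xp = X f b hb p hp
  levels : kt (amt f) b (lvl B) p ≤ℤ kt (amt f) b (lvl B) t ⇔ p ≤ t
  levels = kt-≤⇔ (amt f) b (lvl B) {p} {t}
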